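{- For every $a, b \in \Lambda_{\mathrm{dB}}$ and $i \in \mathbb{N}$, $\mathrm{inc}_i(a[b]) = \mathrm{inc}_{i+1}(a)\big[\mathrm{inc}_i(b)\big]$.
   Context: $\Lambda_{\mathrm{dB}}$ is the set of de Bruijn terms given by $a ::= n \mid a\,a \mid \lambda a$ with $n \in \mathbb{N}_{>0}$. Increment: for $i\in\mathbb{N}$, $\mathrm{inc}_i(n)=n$ if $n\le i$ and $n+1$ if $n>i$; $\mathrm{inc}_i(a\,b)=\mathrm{inc}_i(a)\,\mathrm{inc}_i(b)$; $\mathrm{inc}_i(\lambda a)=\lambda\,\mathrm{inc}_{i+1}(a)$. Swap: for $i\in\mathbb{N}_{>0}$, $\mathrm{sw}_i(n)=n$ if $n<i$ or $n>i+1$, $\mathrm{sw}_i(i)=i+1$, $\mathrm{sw}_i(i+1)=i$; $\mathrm{sw}_i(a\,b)=\mathrm{sw}_i(a)\,\mathrm{sw}_i(b)$; $\mathrm{sw}_i(\lambda a)=\lambda\,\mathrm{sw}_{i+1}(a)$. $\lambda r$ meta-substitution $a[c]$: $1[c]=c$, $n[c]=n-1$ for $n>1$; $(a\,b)[c]=a[c]\,b[c]$; $(\lambda a)[c]=\lambda\big(\mathrm{sw}_1(a)[\mathrm{inc}_0(c)]\big)$. -}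

module Defs where

open import Data.Nat using (ℕ; zero; suc; _+_; _≤ᵇ_)
open import Data.Bool using (if_then_else_)

-- De Bruijn terms  a ::= n | a a | λ a  with n ∈ ℕ_{>0}.
-- Convention: `var k` denotes the de Bruijn index n = k + 1 (so indices are
-- exactly the positive naturals).
data Term : Set where
  var : ℕ → Term
  app : Term → Term → Term
  lam : Term → Term

-- inc_i on indices: n ↦ n if n ≤ i, n+1 if n > i   (n = suc k)
incVar : ℕ → ℕ → ℕ
incVar i k = if suc k ≤ᵇ i then k else suc k

inc : ℕ → Term → Term
inc i (var k)   = var (incVar i k)
inc i (app a b) = app (inc i a) (inc i b)
inc i (lam a)   = lam (inc (suc i) a)

-- sw_i for i ∈ ℕ_{>0}; here `sw j` is sw_{j+1}.  On the index n = k+1: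
-- swaps i and i+1, i.e. k = j ↦ j+1 and k = j+1 ↦ j, otherwise unchanged.
swVar : ℕ → ℕ → ℕ
swVar zero    zero          = suc zero
swVar zero    (suc zero)    = zero
swVar zero    (suc (suc k)) = suc (suc k)
swVar (suc j) zero          = zero
swVar (suc j) (suc k)       = suc (swVar j k)

sw : ℕ → Term → Term
sw j (var k)   = var (swVar j k)
sw j (app a b) = app (sw j a) (sw j b)
sw j (lam a)   = lam (sw (suc j) a)

-- Size of a term (sw preserves it), used as fuel to make the λr
-- substitution structurally recursive; with fuel ≥ size a the fuel is
-- irrelevant and `subst` satisfies exactly the defining equations of a[c].
size : Term → ℕ
size (var k)   = suc zero
size (app a b) = suc (size a + size b)
size (lam a)   = suc (size a)

substF : ℕ → Term → Term → Term
substF zero    a             c = a   -- unreachable when fuel = size a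
substF (suc f) (var zero)    c = c
substF (suc f) (var (suc k)) c = var k
substF (suc f) (app a b)     c = app (substF f a c) (substF f b c)
substF (suc f) (lam a)       c = lam (substF f (sw zero a) (inc zero c))

subst : Term → Term → Term
subst a c = substF (size a) a c

-- Under a binder the claim is needed for sw₁(a) and inc₀(b) at
-- level i + 1, so the λ case rests on two commutation laws: inc_{i+2} commutes
-- with sw₁, and inc_{i+1} ∘ inc₀ = inc₀ ∘ inc_i.
module Submission where

open import Defs
open import Data.Bool using (true; false; if_then_else_)
open import Data.Nat using (ℕ; suc; zero; _+_; _≤_; _<ᵇ_; s≤s)
open import Data.Nat.Properties using (≤-refl; ≤-reflexive; ≤-trans; m≤m+n; m≤n+m)
open import Relation.Binary.PropositionalEquality
  using (_≡_; refl; cong; cong₂; sym; trans; module ≡-Reasoning)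
open ≡-Reasoning

size-inc : ∀ i a → size (inc i a) ≡ size a
size-inc i (var k)   = refl
size-inc i (app a b) = cong suc (cong₂ _+_ (size-inc i a) (size-inc i b))
size-inc i (lam a)   = cong suc (size-inc (suc i) a)

size-sw : ∀ j a → size (sw j a) ≡ size a
size-sw j (var k)   = refl
size-sw j (app a b) = cong suc (cong₂ _+_ (size-sw j a) (size-sw j b))
size-sw j (lam a)   = cong suc (size-sw (suc j) a)

incVar-suc : ∀ i k → incVar (suc i) (suc k) ≡ suc (incVar i k)
incVar-suc i k with k <ᵇ i
... | true  = refl
... | false = refl

incVar-comm : ∀ j i k → incVar (suc (j + i)) (incVar j k) ≡ incVar j (incVar (j + i) k)
incVar-comm zero    i k       = incVar-suc i k
incVar-comm (suc j) i zero    = refl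
incVar-comm (suc j) i (suc k) = begin
  incVar (suc (suc j + i)) (incVar (suc j) (suc k)) ≡⟨ cong (incVar (suc (suc j + i))) (incVar-suc j k) ⟩
  incVar (suc (suc j + i)) (suc (incVar j k))       ≡⟨ incVar-suc (suc (j + i)) (incVar j k) ⟩
  suc (incVar (suc (j + i)) (incVar j k))           ≡⟨ cong suc (incVar-comm j i k) ⟩
  suc (incVar j (incVar (j + i) k))                 ≡⟨ sym (incVar-suc j (incVar (j + i) k)) ⟩
  incVar (suc j) (suc (incVar (j + i) k))           ≡⟨ cong (incVar (suc j)) (sym (incVar-suc (j + i) k)) ⟩
  incVar (suc j) (incVar (suc j + i) (suc k))       ∎

inc-comm : ∀ j i c → inc (suc (j + i)) (inc j c) ≡ inc j (inc (j + i) c)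
inc-comm j i (var k)   = cong var (incVar-comm j i k)
inc-comm j i (app a b) = cong₂ app (inc-comm j i a) (inc-comm j i b)
inc-comm j i (lam a)   = cong lam (inc-comm (suc j) i a)

incVar-swVar : ∀ j i k → incVar (suc (suc (j + i))) (swVar j k) ≡ swVar j (incVar (suc (suc (j + i))) k)
incVar-swVar zero    i zero          = refl
incVar-swVar zero    i (suc zero)    = refl
incVar-swVar zero    i (suc (suc k)) rewrite incVar-suc (suc i) (suc k) | incVar-suc i k = refl
incVar-swVar (suc j) i zero          = refl
incVar-swVar (suc j) i (suc k)       = begin
  incVar (suc (suc (suc j + i))) (suc (swVar j k)) ≡⟨ incVar-suc (suc (suc (j + i))) (swVar j k) ⟩
  suc (incVar (suc (suc (j + i))) (swVar j k))     ≡⟨ cong suc (incVar-swVar j i k) ⟩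
  suc (swVar j (incVar (suc (suc (j + i))) k))     ≡⟨ cong (swVar (suc j)) (sym (incVar-suc (suc (suc (j + i))) k)) ⟩
  swVar (suc j) (incVar (suc (suc (suc j + i))) (suc k)) ∎

inc-sw : ∀ j i a → inc (suc (suc (j + i))) (sw j a) ≡ sw j (inc (suc (suc (j + i))) a)
inc-sw j i (var k)   = cong var (incVar-swVar j i k)
inc-sw j i (app a b) = cong₂ app (inc-sw j i a) (inc-sw j i b)
inc-sw j i (lam a)   = cong lam (inc-sw (suc j) i a)

inc-substF : ∀ f a c i → size a ≤ f → inc i (substF f a c) ≡ substF f (inc (suc i) a) (inc i c)
inc-substF (suc f) (var zero)    c i _ = refl
inc-substF (suc f) (var (suc k)) c i _ rewrite incVar-suc i k = refl
inc-substF (suc f) (app a b)     c i (s≤s size≤f) = cong₂ app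
  (inc-substF f a c i (≤-trans (m≤m+n (size a) (size b)) size≤f))
  (inc-substF f b c i (≤-trans (m≤n+m (size b) (size a)) size≤f))
inc-substF (suc f) (lam a)       c i (s≤s size≤f) = cong lam (begin
  inc (suc i) (substF f (sw zero a) (inc zero c))
    ≡⟨ inc-substF f (sw zero a) (inc zero c) (suc i) (≤-trans (≤-reflexive (size-sw zero a)) size≤f) ⟩
  substF f (inc (suc (suc i)) (sw zero a)) (inc (suc i) (inc zero c))
    ≡⟨ cong₂ (substF f) (inc-sw zero i a) (inc-comm zero i c) ⟩
  substF f (sw zero (inc (suc (suc i)) a)) (inc zero (inc i c)) ∎)

lemma18 : (a b : Term) (i : ℕ) → inc i (subst a b) ≡ subst (inc (suc i) a) (inc i b)
lemma18 a b i = begin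
  inc i (substF (size a) a b)                            ≡⟨ inc-substF (size a) a b i ≤-refl ⟩
  substF (size a) (inc (suc i) a) (inc i b)               ≡⟨ cong (λ f → substF f (inc (suc i) a) (inc i b)) (sym (size-inc (suc i) a)) ⟩
  substF (size (inc (suc i) a)) (inc (suc i) a) (inc i b) ∎
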